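{- Let $G_1$ and $G_2$ be graphs with orientations $\vec{G_1}$, $\vec{G_2}$, and let $A$ be an abelian group. If there is an $A$-flow-continuous map $f\colon E(\vec{G_1})\to E(\vec{G_2})$, then for every $Y\subseteq E(G_2)$ we have $G_1-f_*^{ -1}(Y)\succ_A G_2-Y$.
   Context: For an abelian group $A$ and an orientation $\vec{G}$ of a graph $G$, an $A$-flow is a map $\psi\colon E(\vec{G})\to A$ such that at every vertex the sum of incoming values equals the sum of outgoing values. For orientations $\vec{G_1},\vec{G_2}$ of graphs $G_1,G_2$, a map $f\colon E(\vec{G_1})\to E(\vec{G_2})$ is $A$-flow-continuous if for every $A$-flow $\psi$ on $\vec{G_2}$, the composition $\psi\circ f$ is an $A$-flow on $\vec{G_1}$. We write $G_1\succ_A G_2$ if there exist orientations of $G_1,G_2$ and an $A$-flow-continuous map between their arc sets. Such an $f$ induces $f_*\colon E(G_1)\to E(G_2)$ by $f_*(e_1)=e_2$ iff $f$ maps the arc corresponding to $e_1$ to the arc corresponding to $e_2$. -}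

module Defs where

open import Level using (Level; _⊔_)
open import Data.Nat using (ℕ; zero; suc)
open import Data.Bool using (Bool; true; false; if_then_else_)
open import Data.Fin using (Fin; zero; suc; _≟_)
open import Data.Fin.Subset using (Subset)
open import Data.List using (List; []; _∷_; length; lookup)
open import Data.Vec using (Vec; []; _∷_; tabulate)
import Data.Vec as Vec
open import Data.Product using (Σ; _×_; _,_; proj₁; proj₂)
open import Relation.Nullary.Decidable using (does)
open import Algebra.Bundles using (AbelianGroup)

-- A finite (multi)graph: vertex set Fin n, edges given as a list of
-- (unordered) endpoint pairs; loops and parallel edges allowed.
-- The stored order of the endpoints has no meaning until an orientation is chosen.
record Graph : Set where
  constructor graph
  field
    nV    : ℕ
    edges : List (Fin nV × Fin nV)

open Graph public

Edge : Graph → Set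
Edge G = Fin (length (edges G))

-- An orientation of G: for each edge, whether its stored pair is reversed.
Orientation : Graph → Set
Orientation G = Edge G → Bool

tail head : (G : Graph) → Orientation G → Edge G → Fin (nV G)
tail G o e = if o e then proj₂ (lookup (edges G) e) else proj₁ (lookup (edges G) e)
head G o e = if o e then proj₁ (lookup (edges G) e) else proj₂ (lookup (edges G) e)

removeEdges : ∀ {X : Set} (es : List X) → Subset (length es) → List X
removeEdges []       []            = []
removeEdges (x ∷ es) (true  ∷ Y)   = removeEdges es Y
removeEdges (x ∷ es) (false ∷ Y)   = x ∷ removeEdges es Y

_−_ : (G : Graph) → Subset (length (edges G)) → Graph
G − Y = graph (nV G) (removeEdges (edges G) Y)

module _ {c ℓ : Level} (A : AbelianGroup c ℓ) where
  open AbelianGroup A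

  sumA : (m : ℕ) → (Fin m → Carrier) → Carrier
  sumA zero    g = ε
  sumA (suc m) g = g zero ∙ sumA m (λ i → g (suc i))

  IsFlow : (G : Graph) → Orientation G → (Edge G → Carrier) → Set ℓ
  IsFlow G o ψ = ∀ (v : Fin (nV G)) →
    sumA (length (edges G)) (λ e → if does (head G o e ≟ v) then ψ e else ε)
      ≈ sumA (length (edges G)) (λ e → if does (tail G o e ≟ v) then ψ e else ε)

  FlowContinuous : (G₁ G₂ : Graph) → Orientation G₁ → Orientation G₂
                 → (Edge G₁ → Edge G₂) → Set (c ⊔ ℓ)
  FlowContinuous G₁ G₂ o₁ o₂ f =
    ∀ (ψ : Edge G₂ → Carrier) → IsFlow G₂ o₂ ψ → IsFlow G₁ o₁ (λ e → ψ (f e))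

  _≻_ : Graph → Graph → Set (c ⊔ ℓ)
  G₁ ≻ G₂ = Σ (Orientation G₁) λ o₁ → Σ (Orientation G₂) λ o₂ →
              Σ (Edge G₁ → Edge G₂) λ f → FlowContinuous G₁ G₂ o₁ o₂ f

preimage : (G₁ G₂ : Graph) → (Edge G₁ → Edge G₂) → Subset (length (edges G₂))
         → Subset (length (edges G₁))
preimage G₁ G₂ f Y = tabulate (λ e → Vec.lookup Y (f e))

{-# OPTIONS --safe #-}
-- Edges of G − Y are the edges of G outside Y, so a flow on G − Y extends by
-- zero to a flow on G, and a flow on G vanishing on Y restricts to a flow on
-- G − Y: removing arcs that carry 0 changes no vertex balance. Given a flow ψ
-- on G₂ − Y, extend it to G₂, pull it back along f to a flow on G₁, which
-- vanishes on f_*⁻¹(Y), and restrict it to G₁ − f_*⁻¹(Y); this is ψ ∘ f'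
-- for the restriction f' of f.
module Submission where

open import Defs
open import Level using (Level)
open import Data.Bool using (true; false; if_then_else_)
open import Data.Fin using (Fin; zero; suc; _≟_)
open import Data.Fin.Subset using (Subset)
open import Data.List using (List; []; _∷_; length; lookup)
open import Data.Nat using (ℕ; zero; suc)
open import Data.Product using (∃; _,_; proj₁; proj₂; map₂)
open import Data.Vec using ([]; _∷_)
import Data.Vec as Vec
open import Data.Vec.Properties using (lookup∘tabulate)
open import Function using (_∘_)
open import Relation.Binary.PropositionalEquality using (_≡_; refl; sym; trans; cong)
open import Relation.Nullary.Decidable using (does)
open import Algebra.Bundles using (AbelianGroup)

module _ {X : Set} where

  kept : (es : List X) (Y : Subset (length es)) →
         Fin (length (removeEdges es Y)) → Fin (length es)
  kept [] [] ()
  kept (x ∷ es) (true  ∷ Y) i       = suc (kept es Y i)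
  kept (x ∷ es) (false ∷ Y) zero    = zero
  kept (x ∷ es) (false ∷ Y) (suc i) = suc (kept es Y i)

  lookup-kept : (es : List X) (Y : Subset (length es)) (i : Fin (length (removeEdges es Y))) →
                lookup (removeEdges es Y) i ≡ lookup es (kept es Y i)
  lookup-kept [] [] ()
  lookup-kept (x ∷ es) (true  ∷ Y) i       = lookup-kept es Y i
  lookup-kept (x ∷ es) (false ∷ Y) zero    = refl
  lookup-kept (x ∷ es) (false ∷ Y) (suc i) = lookup-kept es Y i

  kept-∉ : (es : List X) (Y : Subset (length es)) (i : Fin (length (removeEdges es Y))) →
           Vec.lookup Y (kept es Y i) ≡ false
  kept-∉ [] [] ()
  kept-∉ (x ∷ es) (true  ∷ Y) i       = kept-∉ es Y i
  kept-∉ (x ∷ es) (false ∷ Y) zero    = refl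
  kept-∉ (x ∷ es) (false ∷ Y) (suc i) = kept-∉ es Y i

  kept-surjective : (es : List X) (Y : Subset (length es)) (j : Fin (length es)) →
                    Vec.lookup Y j ≡ false → ∃ λ i → kept es Y i ≡ j
  kept-surjective (x ∷ es) (true  ∷ Y) (suc j) j∉Y = map₂ (cong suc) (kept-surjective es Y j j∉Y)
  kept-surjective (x ∷ es) (false ∷ Y) zero    j∉Y = zero , refl
  kept-surjective (x ∷ es) (false ∷ Y) (suc j) j∉Y =
    let i , kept-i≡j = kept-surjective es Y j j∉Y in suc i , cong suc kept-i≡j

  extend : ∀ {b} {B : Set b} → B → (es : List X) (Y : Subset (length es)) →
           (Fin (length (removeEdges es Y)) → B) → Fin (length es) → B
  extend d (x ∷ es) (true  ∷ Y) g zero    = d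
  extend d (x ∷ es) (true  ∷ Y) g (suc j) = extend d es Y g j
  extend d (x ∷ es) (false ∷ Y) g zero    = g zero
  extend d (x ∷ es) (false ∷ Y) g (suc j) = extend d es Y (g ∘ suc) j

  extend-kept : ∀ {b} {B : Set b} (d : B) (es : List X) (Y : Subset (length es))
                (g : Fin (length (removeEdges es Y)) → B) (i : Fin (length (removeEdges es Y))) →
                extend d es Y g (kept es Y i) ≡ g i
  extend-kept d [] [] g ()
  extend-kept d (x ∷ es) (true  ∷ Y) g i       = extend-kept d es Y g i
  extend-kept d (x ∷ es) (false ∷ Y) g zero    = refl
  extend-kept d (x ∷ es) (false ∷ Y) g (suc i) = extend-kept d es Y (g ∘ suc) i

  extend-∈ : ∀ {b} {B : Set b} (d : B) (es : List X) (Y : Subset (length es))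
             (g : Fin (length (removeEdges es Y)) → B) (j : Fin (length es)) →
             Vec.lookup Y j ≡ true → extend d es Y g j ≡ d
  extend-∈ d (x ∷ es) (true  ∷ Y) g zero    j∈Y = refl
  extend-∈ d (x ∷ es) (true  ∷ Y) g (suc j) j∈Y = extend-∈ d es Y g j j∈Y
  extend-∈ d (x ∷ es) (false ∷ Y) g (suc j) j∈Y = extend-∈ d es Y (g ∘ suc) j j∈Y

keptEdge : (G : Graph) (Y : Subset (length (edges G))) → Edge (G − Y) → Edge G
keptEdge G = kept (edges G)

restrictOrientation : (G : Graph) (Y : Subset (length (edges G))) → Orientation G → Orientation (G − Y)
restrictOrientation G Y o = o ∘ keptEdge G Y

head-kept : (G : Graph) (Y : Subset (length (edges G))) (o : Orientation G) (i : Edge (G − Y)) →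
            head (G − Y) (restrictOrientation G Y o) i ≡ head G o (keptEdge G Y i)
head-kept G Y o i rewrite lookup-kept (edges G) Y i = refl

tail-kept : (G : Graph) (Y : Subset (length (edges G))) (o : Orientation G) (i : Edge (G − Y)) →
            tail (G − Y) (restrictOrientation G Y o) i ≡ tail G o (keptEdge G Y i)
tail-kept G Y o i rewrite lookup-kept (edges G) Y i = refl

lookup-preimage : (G₁ G₂ : Graph) (f : Edge G₁ → Edge G₂) (Y : Subset (length (edges G₂)))
                  (e : Edge G₁) → Vec.lookup (preimage G₁ G₂ f Y) e ≡ Vec.lookup Y (f e)
lookup-preimage G₁ G₂ f Y = lookup∘tabulate (λ e → Vec.lookup Y (f e))

restrictMap : (G₁ G₂ : Graph) (f : Edge G₁ → Edge G₂) (Y : Subset (length (edges G₂))) →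
              Edge (G₁ − preimage G₁ G₂ f Y) → Edge (G₂ − Y)
restrictMap G₁ G₂ f Y i = proj₁ (kept-surjective (edges G₂) Y (f e) f-e∉Y)
  where
    X = preimage G₁ G₂ f Y
    e = keptEdge G₁ X i
    f-e∉Y : Vec.lookup Y (f e) ≡ false
    f-e∉Y = trans (sym (lookup-preimage G₁ G₂ f Y e)) (kept-∉ (edges G₁) X i)

keptEdge-restrictMap : (G₁ G₂ : Graph) (f : Edge G₁ → Edge G₂) (Y : Subset (length (edges G₂)))
                       (i : Edge (G₁ − preimage G₁ G₂ f Y)) →
                       keptEdge G₂ Y (restrictMap G₁ G₂ f Y i) ≡ f (keptEdge G₁ (preimage G₁ G₂ f Y) i)
keptEdge-restrictMap G₁ G₂ f Y i = proj₂ (kept-surjective (edges G₂) Y _ _)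

module _ {c ℓ : Level} (A : AbelianGroup c ℓ) where
  open AbelianGroup A
    using (Carrier; _≈_; _∙_; ε; setoid; reflexive; ∙-cong; ∙-congˡ; ∙-congʳ; identityˡ)
    renaming (refl to ≈-refl)
  open import Relation.Binary.Reasoning.Setoid setoid

  VanishesOn : {m : ℕ} → (Fin m → Carrier) → Subset m → Set ℓ
  VanishesOn φ Y = ∀ j → Vec.lookup Y j ≡ true → φ j ≈ ε

  sumA-cong : (m : ℕ) {φ χ : Fin m → Carrier} → (∀ i → φ i ≈ χ i) → sumA A m φ ≈ sumA A m χ
  sumA-cong zero    φ≈χ = ≈-refl
  sumA-cong (suc m) φ≈χ = ∙-cong (φ≈χ zero) (sumA-cong m (φ≈χ ∘ suc))

  sumA-removeEdges : {X : Set} (es : List X) (Y : Subset (length es)) (φ : Fin (length es) → Carrier) →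
                     VanishesOn φ Y →
                     sumA A (length (removeEdges es Y)) (φ ∘ kept es Y) ≈ sumA A (length es) φ
  sumA-removeEdges []       []          φ φ|Y≈0 = ≈-refl
  sumA-removeEdges (x ∷ es) (true  ∷ Y) φ φ|Y≈0 = begin
    sumA A _ (φ ∘ suc ∘ kept es Y)     ≈⟨ sumA-removeEdges es Y (φ ∘ suc) (φ|Y≈0 ∘ suc) ⟩
    sumA A _ (φ ∘ suc)                 ≈⟨ identityˡ _ ⟨
    ε ∙ sumA A _ (φ ∘ suc)             ≈⟨ ∙-congʳ (φ|Y≈0 zero refl) ⟨
    φ zero ∙ sumA A _ (φ ∘ suc)        ∎
  sumA-removeEdges (x ∷ es) (false ∷ Y) φ φ|Y≈0 =
    ∙-congˡ (sumA-removeEdges es Y (φ ∘ suc) (φ|Y≈0 ∘ suc))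

  -- IsFlow A G o φ unfolds to  ∀ v → fibreSum (head G o) φ v ≈ fibreSum (tail G o) φ v.
  fibreSum : {m n : ℕ} → (Fin m → Fin n) → (Fin m → Carrier) → Fin n → Carrier
  fibreSum {m} x φ v = sumA A m (λ e → if does (x e ≟ v) then φ e else ε)

  fibreSum-cong : {m n : ℕ} (x : Fin m → Fin n) {φ χ : Fin m → Carrier} →
                  (∀ e → φ e ≈ χ e) → ∀ v → fibreSum x φ v ≈ fibreSum x χ v
  fibreSum-cong x φ≈χ v = sumA-cong _ λ e → if-cong (does (x e ≟ v)) (φ≈χ e)
    where
      if-cong : ∀ b {a a′} → a ≈ a′ → (if b then a else ε) ≈ (if b then a′ else ε)
      if-cong true  a≈a′ = a≈a′
      if-cong false a≈a′ = ≈-refl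

  fibreSum-removeEdges : {X : Set} {n : ℕ} (es : List X) (Y : Subset (length es))
                         (x : Fin (length es) → Fin n) (x′ : Fin (length (removeEdges es Y)) → Fin n) →
                         (∀ i → x′ i ≡ x (kept es Y i)) →
                         (φ : Fin (length es) → Carrier) → VanishesOn φ Y →
                         ∀ v → fibreSum x′ (φ ∘ kept es Y) v ≈ fibreSum x φ v
  fibreSum-removeEdges es Y x x′ x′≡x∘kept φ φ|Y≈0 v = begin
    fibreSum x′ (φ ∘ kept es Y) v      ≈⟨ sumA-cong _ (λ i → reflexive (cong (fibreTerm′ i) (x′≡x∘kept i))) ⟩
    sumA A _ (fibreTerm ∘ kept es Y)   ≈⟨ sumA-removeEdges es Y fibreTerm fibreTerm|Y≈0 ⟩
    fibreSum x φ v                     ∎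
    where
      fibreTerm′ : Fin (length (removeEdges es Y)) → Fin _ → Carrier
      fibreTerm′ i w = if does (w ≟ v) then φ (kept es Y i) else ε
      fibreTerm : Fin (length es) → Carrier
      fibreTerm e = if does (x e ≟ v) then φ e else ε
      fibreTerm|Y≈0 : VanishesOn fibreTerm Y
      fibreTerm|Y≈0 j j∈Y with does (x j ≟ v)
      ... | true  = φ|Y≈0 j j∈Y
      ... | false = ≈-refl

  IsFlow-cong : (G : Graph) (o : Orientation G) {φ χ : Edge G → Carrier} →
                (∀ e → φ e ≈ χ e) → IsFlow A G o φ → IsFlow A G o χ
  IsFlow-cong G o φ≈χ balanced v = begin
    fibreSum (head G o) _ v   ≈⟨ fibreSum-cong (head G o) φ≈χ v ⟨
    fibreSum (head G o) _ v   ≈⟨ balanced v ⟩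
    fibreSum (tail G o) _ v   ≈⟨ fibreSum-cong (tail G o) φ≈χ v ⟩
    fibreSum (tail G o) _ v   ∎

  module _ (G : Graph) (o : Orientation G) (Y : Subset (length (edges G)))
           (φ : Edge G → Carrier) (φ|Y≈0 : VanishesOn φ Y) where

    private
      o′ = restrictOrientation G Y o

      inflow-removeEdges : ∀ v → fibreSum (head (G − Y) o′) (φ ∘ keptEdge G Y) v ≈ fibreSum (head G o) φ v
      inflow-removeEdges = fibreSum-removeEdges (edges G) Y (head G o) _ (head-kept G Y o) φ φ|Y≈0

      outflow-removeEdges : ∀ v → fibreSum (tail (G − Y) o′) (φ ∘ keptEdge G Y) v ≈ fibreSum (tail G o) φ v
      outflow-removeEdges = fibreSum-removeEdges (edges G) Y (tail G o) _ (tail-kept G Y o) φ φ|Y≈0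

    restrict-IsFlow : IsFlow A G o φ → IsFlow A (G − Y) o′ (φ ∘ keptEdge G Y)
    restrict-IsFlow balanced v = begin
      fibreSum (head (G − Y) o′) _ v   ≈⟨ inflow-removeEdges v ⟩
      fibreSum (head G o) φ v          ≈⟨ balanced v ⟩
      fibreSum (tail G o) φ v          ≈⟨ outflow-removeEdges v ⟨
      fibreSum (tail (G − Y) o′) _ v   ∎

    unrestrict-IsFlow : IsFlow A (G − Y) o′ (φ ∘ keptEdge G Y) → IsFlow A G o φ
    unrestrict-IsFlow balanced v = begin
      fibreSum (head G o) φ v          ≈⟨ inflow-removeEdges v ⟨
      fibreSum (head (G − Y) o′) _ v   ≈⟨ balanced v ⟩
      fibreSum (tail (G − Y) o′) _ v   ≈⟨ outflow-removeEdges v ⟩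
      fibreSum (tail G o) φ v          ∎

  extendByZero : (G : Graph) (Y : Subset (length (edges G))) → (Edge (G − Y) → Carrier) → Edge G → Carrier
  extendByZero G = extend ε (edges G)

  extendByZero-IsFlow : (G : Graph) (o : Orientation G) (Y : Subset (length (edges G)))
                        (ψ : Edge (G − Y) → Carrier) →
                        IsFlow A (G − Y) (restrictOrientation G Y o) ψ → IsFlow A G o (extendByZero G Y ψ)
  extendByZero-IsFlow G o Y ψ balanced =
    unrestrict-IsFlow G o Y ψ̂ ψ̂|Y≈0
      (IsFlow-cong (G − Y) (restrictOrientation G Y o) (λ i → reflexive (sym (extend-kept ε (edges G) Y ψ i))) balanced)
    where
      ψ̂ = extendByZero G Y ψ
      ψ̂|Y≈0 : VanishesOn ψ̂ Y
      ψ̂|Y≈0 j j∈Y = reflexive (extend-∈ ε (edges G) Y ψ j j∈Y)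

  restrictMap-FlowContinuous :
    (G₁ G₂ : Graph) (o₁ : Orientation G₁) (o₂ : Orientation G₂) (f : Edge G₁ → Edge G₂) →
    FlowContinuous A G₁ G₂ o₁ o₂ f → (Y : Subset (length (edges G₂))) →
    let X = preimage G₁ G₂ f Y in
    FlowContinuous A (G₁ − X) (G₂ − Y) (restrictOrientation G₁ X o₁) (restrictOrientation G₂ Y o₂)
                   (restrictMap G₁ G₂ f Y)
  restrictMap-FlowContinuous G₁ G₂ o₁ o₂ f continuous Y ψ balanced =
    IsFlow-cong (G₁ − X) (restrictOrientation G₁ X o₁) pullback≈
      (restrict-IsFlow G₁ o₁ X (ψ̂ ∘ f) ψ̂∘f|X≈0 (continuous ψ̂ (extendByZero-IsFlow G₂ o₂ Y ψ balanced)))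
    where
      X  = preimage G₁ G₂ f Y
      ψ̂ = extendByZero G₂ Y ψ
      ψ̂∘f|X≈0 : VanishesOn (ψ̂ ∘ f) X
      ψ̂∘f|X≈0 j j∈X = reflexive (extend-∈ ε (edges G₂) Y ψ (f j) (trans (sym (lookup-preimage G₁ G₂ f Y j)) j∈X))
      pullback≈ : ∀ i → ψ̂ (f (keptEdge G₁ X i)) ≈ ψ (restrictMap G₁ G₂ f Y i)
      pullback≈ i = reflexive (trans (cong ψ̂ (sym (keptEdge-restrictMap G₁ G₂ f Y i)))
                                     (extend-kept ε (edges G₂) Y ψ (restrictMap G₁ G₂ f Y i)))

lemma2p1 : {c ℓ : Level} (A : AbelianGroup c ℓ) (G₁ G₂ : Graph)
    (o₁ : Orientation G₁) (o₂ : Orientation G₂) (f : Edge G₁ → Edge G₂) →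
    FlowContinuous A G₁ G₂ o₁ o₂ f →
    (Y : Subset (length (edges G₂))) →
    _≻_ A (G₁ − preimage G₁ G₂ f Y) (G₂ − Y)
lemma2p1 A G₁ G₂ o₁ o₂ f continuous Y =
  restrictOrientation G₁ (preimage G₁ G₂ f Y) o₁ , restrictOrientation G₂ Y o₂ , restrictMap G₁ G₂ f Y ,
  restrictMap-FlowContinuous A G₁ G₂ o₁ o₂ f continuous Y
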